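{- Let $G$ be a connected graph with at least one edge. For any integers $b\ge1$ and $c\ge1$, $T_G(b)\ge b+c$ if and only if $\chi_c(G)\le b+c$.
   Context: A vertex cover of $G$ is a set $S$ of vertices such that $V(G)\setminus S$ is independent. For a family (with repetitions allowed) $S_1,\dots,S_t$ of vertex covers, its budget is $\max_{v}|\{i:v\in S_i\}|$; $T_G(b)$ is the largest $t$ such that some family of $t$ vertex covers of $G$ has budget at most $b$. The lexicographic product $G\cdot K_c$ has vertex set $V(G)\times[c]$, with distinct $(u,a)$ and $(v,b')$ adjacent iff $uv\in E(G)$ or $u=v$. The $c$-fold chromatic number is $\chi_c(G) = \chi(G\cdot K_c)$. -}

module Defs where

open import Data.Nat using (ℕ; _≤_; _+_)
open import Data.Fin using (Fin)
open import Data.Bool using (Bool; true; false; if_then_else_)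
open import Data.List using (List; map; allFin)
open import Data.Nat.ListAction using (sum)
open import Data.Product using (_×_; _,_; Σ; ∃; ∃-syntax)
open import Data.Sum using (_⊎_)
open import Relation.Nullary using (¬_)
open import Relation.Binary.PropositionalEquality using (_≡_; _≢_)
open import Relation.Binary.Construct.Closure.ReflexiveTransitive using (Star)

record Graph (n : ℕ) : Set₁ where
  field
    Adj     : Fin n → Fin n → Set
    symm    : ∀ {u v} → Adj u v → Adj v u
    irrefl  : ∀ {u} → ¬ Adj u u
open Graph public

Connected : ∀ {n} → Graph n → Set
Connected G = ∀ u v → Star (Adj G) u v

HasEdge : ∀ {n} → Graph n → Set
HasEdge G = ∃[ u ] ∃[ v ] Adj G u v

VSet : ℕ → Set
VSet n = Fin n → Bool

IsVertexCover : ∀ {n} → Graph n → VSet n → Set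
IsVertexCover G S = ∀ u v → Adj G u v → ¬ (S u ≡ false × S v ≡ false)

multiplicity : ∀ {n t} → (Fin t → VSet n) → Fin n → ℕ
multiplicity {t = t} S v = sum (map (λ i → if S i v then 1 else 0) (allFin t))

BudgetAtMost : ∀ {n t} → (Fin t → VSet n) → ℕ → Set
BudgetAtMost S b = ∀ v → multiplicity S v ≤ b

CoverFamily : ∀ {n} → Graph n → (b t : ℕ) → Set
CoverFamily {n} G b t =
  Σ (Fin t → VSet n) λ S → (∀ i → IsVertexCover G (S i)) × BudgetAtMost S b

-- T_G(b) ≥ k : the largest admissible t is at least k, i.e. some admissible t ≥ k.
T≥ : ∀ {n} → Graph n → (b k : ℕ) → Set
T≥ G b k = ∃[ t ] (k ≤ t × CoverFamily G b t)

LexAdj : ∀ {n} → Graph n → (c : ℕ) → Fin n × Fin c → Fin n × Fin c → Set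
LexAdj G c (u , a) (v , a′) = ((u , a) ≢ (v , a′)) × (Adj G u v ⊎ u ≡ v)

ProperLexColouring : ∀ {n} → Graph n → (c k : ℕ) → (Fin n × Fin c → Fin k) → Set
ProperLexColouring G c k f = ∀ x y → LexAdj G c x y → f x ≢ f y

-- χ_c(G) = χ(G · K_c) ≤ k
χ≤ : ∀ {n} → Graph n → (c k : ℕ) → Set
χ≤ {n} G c k = ∃[ f ] ProperLexColouring G c k f

{-# OPTIONS --safe #-}
-- A colouring of G · K_c with b + c colours assigns to every vertex c distinct
-- colours, adjacent vertices receiving disjoint sets. The vertices avoiding
-- colour i then form a vertex cover S_i, and every vertex lies in exactly b of
-- the b + c covers. Conversely, if b + c covers have budget b, each vertex is
-- missed by at least c of them, and giving it c such indices as its colours is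
-- proper because two adjacent vertices are never both missed by one cover.
module Submission where

open import Defs
open import Data.Nat using (ℕ; zero; suc; _≤_; _+_; z≤n; s≤s)
open import Data.Nat.Properties
  using (+-0-commutativeMonoid; ≤-refl; +-monoˡ-≤; +-monoʳ-≤; +-cancelˡ-≤; +-comm; module ≤-Reasoning)
open import Algebra.Properties.CommutativeMonoid.Sum +-0-commutativeMonoid
  using (sum; sum-remove; sum-cong-≗; ∑-distrib-+)
open import Data.Bool using (Bool; true; false; not; if_then_else_)
open import Data.Bool.Properties using (not-involutive; not-injective)
open import Data.Fin using (Fin; zero; suc; inject≤; punchIn; punchOut; _≟_)
open import Data.Fin.Properties
  using (0≢1+n; suc-injective; punchIn-punchOut; punchOut-injective; inject≤-injective; any?)
open import Data.List using (tabulate; map; allFin)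
open import Data.List.Properties using (map-tabulate)
import Data.Nat.ListAction as List
open import Data.Product using (Σ; ∃; _×_; _,_; proj₁; proj₂)
open import Data.Sum using (inj₁; inj₂)
open import Function using (_∘_; id)
open import Function.Definitions using (Injective)
open import Relation.Nullary using (yes; no; does)
open import Relation.Nullary.Decidable using (dec-true; decidable-stable)
open import Relation.Binary.PropositionalEquality

sum-const-1 : ∀ k → sum {k} (λ _ → 1) ≡ k
sum-const-1 zero    = refl
sum-const-1 (suc k) = cong suc (sum-const-1 k)

sum-tabulate : ∀ {k} (h : Fin k → ℕ) → List.sum (tabulate h) ≡ sum h
sum-tabulate {zero}  h = refl
sum-tabulate {suc k} h = cong (h zero +_) (sum-tabulate (h ∘ suc))

-- The terms after g 0 are indexed by an injection into Fin k with g 0 punched out.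
sum-injective-≤ : ∀ {c k} (h : Fin k → ℕ) {g : Fin c → Fin k} →
  Injective _≡_ _≡_ g → sum (h ∘ g) ≤ sum h
sum-injective-≤ {zero}          h g-inj = z≤n
sum-injective-≤ {suc c} {zero}  h {g} g-inj with g zero
... | ()
sum-injective-≤ {suc c} {suc k} h {g} g-inj = begin
  h g₀ + sum (h ∘ g ∘ suc)               ≡⟨ cong (h g₀ +_) (sum-cong-≗ (cong h ∘ punchIn-punchOut ∘ g₀≢)) ⟨
  h g₀ + sum (h ∘ punchIn g₀ ∘ g′)       ≤⟨ +-monoʳ-≤ (h g₀) (sum-injective-≤ (h ∘ punchIn g₀) g′-injective) ⟩
  h g₀ + sum (h ∘ punchIn g₀)            ≡⟨ sum-remove h ⟨
  sum h                                  ∎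
  where
  open ≤-Reasoning
  g₀ = g zero
  g₀≢ : ∀ a → g₀ ≢ g (suc a)
  g₀≢ a = 0≢1+n ∘ g-inj
  g′ : Fin c → Fin k
  g′ a = punchOut (g₀≢ a)
  g′-injective : Injective _≡_ _≡_ g′
  g′-injective eq = suc-injective (g-inj (punchOut-injective (g₀≢ _) (g₀≢ _) eq))

indicator : Bool → ℕ
indicator b = if b then 1 else 0

count : ∀ {k} → (Fin k → Bool) → ℕ
count P = sum (indicator ∘ P)

multiplicity≡count : ∀ {n t} (S : Fin t → VSet n) v → multiplicity S v ≡ count (λ i → S i v)
multiplicity≡count {t = t} S v = begin
  List.sum (map row (allFin t))    ≡⟨ cong List.sum (map-tabulate {n = t} id row) ⟩
  List.sum (tabulate {n = t} row)  ≡⟨ sum-tabulate row ⟩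
  count (λ i → S i v)              ∎
  where
  open ≡-Reasoning
  row : Fin t → ℕ
  row i = indicator (S i v)

count-injective-≤ : ∀ {c k} (P : Fin k → Bool) {g : Fin c → Fin k} →
  Injective _≡_ _≡_ g → count (P ∘ g) ≤ count P
count-injective-≤ P = sum-injective-≤ (indicator ∘ P)

injection⇒≤count : ∀ {c k} (P : Fin k → Bool) {g : Fin c → Fin k} →
  Injective _≡_ _≡_ g → (∀ a → P (g a) ≡ true) → c ≤ count P
injection⇒≤count {c} P g-inj true-on-g =
  subst (_≤ count P) (trans (sum-cong-≗ (cong indicator ∘ true-on-g)) (sum-const-1 c))
    (count-injective-≤ P g-inj)

count+count-not : ∀ {k} (P : Fin k → Bool) → count P + count (not ∘ P) ≡ k
count+count-not {k} P = begin
  count P + count (not ∘ P)                     ≡⟨ ∑-distrib-+ (indicator ∘ P) (indicator ∘ not ∘ P) ⟨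
  sum (λ i → indicator (P i) + indicator (not (P i))) ≡⟨ sum-cong-≗ (indicator+indicator-not ∘ P) ⟩
  sum {k} (λ _ → 1)                             ≡⟨ sum-const-1 k ⟩
  k                                             ∎
  where
  open ≡-Reasoning
  indicator+indicator-not : ∀ b → indicator b + indicator (not b) ≡ 1
  indicator+indicator-not true  = refl
  indicator+indicator-not false = refl

≤count⇒injection : ∀ {c k} (P : Fin k → Bool) → c ≤ count P →
  Σ (Fin c → Fin k) λ g → Injective _≡_ _≡_ g × (∀ a → P (g a) ≡ true)
≤count⇒injection {zero} P _ = (λ ()) , (λ { {()} }) , (λ ())
≤count⇒injection {suc c} {zero} P ()
≤count⇒injection {suc c} {suc k} P c≤count with P zero in P₀
... | false = let g , g-inj , true-on-g = ≤count⇒injection (P ∘ suc) c≤count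
              in suc ∘ g , g-inj ∘ suc-injective , true-on-g
... | true with s≤s c≤count′ ← c≤count =
  let g , g-inj , true-on-g = ≤count⇒injection (P ∘ suc) c≤count′
  in extend g , extend-injective g-inj , extend-true true-on-g
  where
  extend : (Fin c → Fin k) → Fin (suc c) → Fin (suc k)
  extend g zero    = zero
  extend g (suc a) = suc (g a)
  extend-injective : ∀ {g} → Injective _≡_ _≡_ g → Injective _≡_ _≡_ (extend g)
  extend-injective g-inj {zero}  {zero}  _  = refl
  extend-injective g-inj {suc a} {suc b} eq = cong suc (g-inj (suc-injective eq))
  extend-true : ∀ {g} → (∀ a → P (suc (g a)) ≡ true) → ∀ a → P (extend g a) ≡ true
  extend-true true-on-g zero    = P₀
  extend-true true-on-g (suc a) = true-on-g a

complement-≤ : ∀ {x y b c} → x + y ≡ b + c → x ≤ b → c ≤ y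
complement-≤ {x} {y} {b} {c} x+y≡b+c x≤b = +-cancelˡ-≤ b c y (begin
  b + c  ≡⟨ x+y≡b+c ⟨
  x + y  ≤⟨ +-monoˡ-≤ y x≤b ⟩
  b + y  ∎)
  where open ≤-Reasoning

count≤⇒≤count-not : ∀ {b c} (P : Fin (b + c) → Bool) → count P ≤ b → c ≤ count (not ∘ P)
count≤⇒≤count-not P = complement-≤ (count+count-not P)

≤count-not⇒count≤ : ∀ {b c} (P : Fin (b + c) → Bool) → c ≤ count (not ∘ P) → count P ≤ b
≤count-not⇒count≤ {b} {c} P = complement-≤ (begin
  c + b                       ≡⟨ +-comm c b ⟩
  b + c                       ≡⟨ count+count-not P ⟨
  count P + count (not ∘ P)   ≡⟨ +-comm (count P) _ ⟩
  count (not ∘ P) + count P   ∎)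
  where open ≡-Reasoning

inImage : ∀ {c k} → (Fin c → Fin k) → Fin k → Bool
inImage g i = does (any? λ a → g a ≟ i)

inImage-image : ∀ {c k} (g : Fin c → Fin k) a → inImage g (g a) ≡ true
inImage-image g a = dec-true (any? λ a′ → g a′ ≟ g a) (a , refl)

inImage⇒∃ : ∀ {c k} (g : Fin c → Fin k) {i} → inImage g i ≡ true → ∃ λ a → g a ≡ i
inImage⇒∃ g {i} _ with any? (λ a → g a ≟ i)
inImage⇒∃ g _  | yes g⁻¹i = g⁻¹i
inImage⇒∃ g () | no _

coverFamily-≤ : ∀ {n} (G : Graph n) {b k t} → k ≤ t → CoverFamily G b t → CoverFamily G b k
coverFamily-≤ G {b} {k} {t} k≤t (S , cover , budget) = S ∘ embed , cover ∘ embed , budget′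
  where
  embed : Fin k → Fin t
  embed i = inject≤ i k≤t
  budget′ : BudgetAtMost (S ∘ embed) b
  budget′ v = begin
    multiplicity (S ∘ embed) v  ≡⟨ multiplicity≡count (S ∘ embed) v ⟩
    count (λ i → S (embed i) v) ≤⟨ count-injective-≤ (λ i → S i v) (inject≤-injective k≤t k≤t _ _) ⟩
    count (λ i → S i v)         ≡⟨ multiplicity≡count S v ⟨
    multiplicity S v            ≤⟨ budget v ⟩
    b                           ∎
    where open ≤-Reasoning

coverFamily⇒colouring : ∀ {n} (G : Graph n) {b c} → CoverFamily G b (b + c) → χ≤ G c (b + c)
coverFamily⇒colouring {n} G {b} {c} (S , cover , budget) = colour , proper
  where
  avoiders : ∀ v → Σ (Fin c → Fin (b + c)) λ g →
    Injective _≡_ _≡_ g × (∀ a → not (S (g a) v) ≡ true)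
  avoiders v = ≤count⇒injection (λ i → not (S i v))
    (count≤⇒≤count-not (λ i → S i v) (subst (_≤ b) (multiplicity≡count S v) (budget v)))
  colour : Fin n × Fin c → Fin (b + c)
  colour (v , a) = proj₁ (avoiders v) a
  avoids : ∀ v a → S (colour (v , a)) v ≡ false
  avoids v a = not-injective (proj₂ (proj₂ (avoiders v)) a)
  proper : ProperLexColouring G c (b + c) colour
  proper (u , a) (v , a′) (distinct , inj₂ refl) same =
    distinct (cong (u ,_) (proj₁ (proj₂ (avoiders u)) same))
  proper (u , a) (v , a′) (_ , inj₁ uv) same =
    cover (colour (u , a)) u v uv (avoids u a , subst (λ i → S i v ≡ false) (sym same) (avoids v a′))

colouring⇒coverFamily : ∀ {n} (G : Graph n) {b c} → χ≤ G c (b + c) → CoverFamily G b (b + c)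
colouring⇒coverFamily {n} G {b} {c} (colour , proper) = S , cover , budget
  where
  colours : Fin n → Fin c → Fin (b + c)
  colours v a = colour (v , a)
  S : Fin (b + c) → VSet n
  S i v = not (inImage (colours v) i)
  colours-injective : ∀ v → Injective _≡_ _≡_ (colours v)
  colours-injective v {a} {a′} same = decidable-stable (a ≟ a′) λ a≢a′ →
    proper (v , a) (v , a′) (a≢a′ ∘ cong proj₂ , inj₂ refl) same
  cover : ∀ i → IsVertexCover G (S i)
  cover i u v uv (u∉S , v∉S) with inImage⇒∃ (colours u) (not-injective u∉S)
                                | inImage⇒∃ (colours v) (not-injective v∉S)
  ... | a , ua≡i | a′ , va′≡i =
    proper (u , a) (v , a′) (adjacent-distinct , inj₁ uv) (trans ua≡i (sym va′≡i))
    where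
    adjacent-distinct : (u , a) ≢ (v , a′)
    adjacent-distinct refl = irrefl G uv
  budget : BudgetAtMost S b
  budget v = subst (_≤ b) (sym (multiplicity≡count S v))
    (≤count-not⇒count≤ (λ i → S i v)
      (injection⇒≤count (λ i → not (S i v)) (colours-injective v)
        λ a → trans (not-involutive _) (inImage-image (colours v) a)))

theorem6 : ∀ {n} (G : Graph n) → Connected G → HasEdge G →
    ∀ (b c : ℕ) → 1 ≤ b → 1 ≤ c →
    (T≥ G b (b + c) → χ≤ G c (b + c)) × (χ≤ G c (b + c) → T≥ G b (b + c))
theorem6 G _ _ b c _ _ =
  (λ (t , b+c≤t , family) → coverFamily⇒colouring G (coverFamily-≤ G b+c≤t family)) ,
  (λ colouring → b + c , ≤-refl , colouring⇒coverFamily G colouring)
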